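{- Let $G=(V,E)$ be an st-graph and let $S_c=\{C_1,C_2\}$ be a channel decomposition of $G$ of size $2$. Define a $2$-dimensional drawing $\Gamma$ by letting $X(v)$ be the position in $C_1$ of $\mathrm{Proj}_{C_1}(v)$ and $Y(v)$ the position in $C_2$ of $\mathrm{Proj}_{C_2}(v)$, for every $v\in V$. Then $\Gamma$ is a dominance drawing of $G$.
   Context: An st-graph is a directed acyclic graph with exactly one source $s$ and one sink $t$. Vertex $v$ is reachable from $u$ if there is a directed path (possibly of length zero) from $u$ to $v$. A channel is a sequence of vertices such that for any two distinct vertices $v,w$ in it, $v$ precedes $w$ iff $w$ is reachable from $v$. A channel decomposition of size $k$ is a set of $k$ channels such that $s$ and $t$ belong to every channel (as first and last element) and every other vertex belongs to exactly one channel. Positions in a channel are numbered $0,1,\dots$ with $s$ at position $0$. The projection $\mathrm{Proj}_C(u)$ is the vertex of $C$ of lowest position among the vertices of $C$ reachable from $u$ (so $\mathrm{Proj}_C(u)=u$ if $u\in C$). $\Gamma$ is a dominance drawing if for all $u,v$: $v$ is reachable from $u$ iff $X(u)\le X(v)$ and $Y(u)\le Y(v)$. -}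

module Defs where

open import Data.Nat using (ℕ)
open import Data.Fin using (Fin; toℕ) renaming (_<_ to _<ᶠ_)
open import Data.List using (List; length; lookup; head; last)
open import Data.List.Membership.Propositional using (_∈_; _∉_)
open import Data.List.Relation.Unary.Unique.Propositional using (Unique)
open import Data.Maybe using (just)
open import Data.Product using (Σ; _×_)
open import Data.Sum using (_⊎_)
open import Relation.Nullary using (¬_)
open import Relation.Binary.PropositionalEquality using (_≡_; _≢_)
open import Relation.Binary.Construct.Closure.ReflexiveTransitive using (Star)
open import Function.Bundles using (_⇔_)

Reach : ∀ {n} → (Fin n → Fin n → Set) → Fin n → Fin n → Set
Reach E = Star E

record IsSTGraph (n : ℕ) (E : Fin n → Fin n → Set) (s t : Fin n) : Set where
  field
    acyclic     : ∀ u v → E u v → ¬ Reach E v u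
    s-source    : ∀ u → ¬ E u s
    s-unique    : ∀ v → (∀ u → ¬ E u v) → v ≡ s
    t-sink      : ∀ u → ¬ E t u
    t-unique    : ∀ v → (∀ u → ¬ E v u) → v ≡ t

record IsChannel {n : ℕ} (E : Fin n → Fin n → Set) (C : List (Fin n)) : Set where
  field
    unique  : Unique C
    ordered : ∀ (i j : Fin (length C)) → lookup C i ≢ lookup C j →
              (i <ᶠ j) ⇔ Reach E (lookup C i) (lookup C j)

record IsChannelDecomposition₂ {n : ℕ} (E : Fin n → Fin n → Set) (s t : Fin n)
                               (C₁ C₂ : List (Fin n)) : Set where
  field
    channel₁  : IsChannel E C₁
    channel₂  : IsChannel E C₂
    distinct  : C₁ ≢ C₂
    first₁    : head C₁ ≡ just s
    last₁     : last C₁ ≡ just t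
    first₂    : head C₂ ≡ just s
    last₂     : last C₂ ≡ just t
    partition : ∀ v → v ≢ s → v ≢ t → (v ∈ C₁ × v ∉ C₂) ⊎ (v ∈ C₂ × v ∉ C₁)

-- IsProjPos E C u p : p is the position in C of Proj_C(u), i.e. p is the
-- lowest position of a vertex of C reachable from u.
IsProjPos : ∀ {n} → (Fin n → Fin n → Set) → List (Fin n) → Fin n → ℕ → Set
IsProjPos E C u p =
  Σ (Fin (length C)) λ i →
    (toℕ i ≡ p) × Reach E u (lookup C i) ×
    (∀ (j : Fin (length C)) → j <ᶠ i → ¬ Reach E u (lookup C j))

IsDominanceDrawing : ∀ {n} → (Fin n → Fin n → Set) → (Fin n → ℕ) → (Fin n → ℕ) → Set
IsDominanceDrawing E X Y =
  ∀ u v → Reach E u v ⇔ (X u Data.Nat.≤ X v × Y u Data.Nat.≤ Y v)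

-- Reachability from u to anything in a channel C is upward closed along C, so
-- Proj_C is monotone along reachability; conversely, if the projection of u
-- lies no higher in C than that of a vertex v of C, then u reaches Proj_C(u),
-- which reaches v within C. Every vertex lies on C₁ or C₂, so for the pair
-- u, v one of the two coordinates witnesses reachability.
module Submission where

open import Defs
open import Data.Nat using (ℕ; _≤_)
open import Data.Nat.Properties using (≤-trans; ≮⇒≥)
open import Data.Fin using (Fin; toℕ) renaming (_≤_ to _≤ᶠ_)
open import Data.Fin.Properties using (_≟_; ≤∧≢⇒<)
open import Data.List using (List; []; _∷_; lookup; head; last)
open import Data.List.Membership.Propositional using (_∈_)
open import Data.List.Relation.Unary.Any using (here; there; index)
open import Data.List.Relation.Unary.Any.Properties using (lookup-index)
open import Data.Maybe using (just)
open import Data.Product using (_×_; _,_; proj₁)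
open import Data.Sum using (_⊎_; inj₁; inj₂; map)
open import Relation.Nullary using (yes; no)
open import Relation.Binary.PropositionalEquality using (_≡_; refl; sym; subst)
open import Relation.Binary.Construct.Closure.ReflexiveTransitive using (ε; _◅◅_)
open import Function.Bundles using (mk⇔; Equivalence)

head≡just⇒∈ : ∀ {a} {A : Set a} (xs : List A) {x : A} → head xs ≡ just x → x ∈ xs
head≡just⇒∈ (y ∷ xs) refl = here refl

last≡just⇒∈ : ∀ {a} {A : Set a} (xs : List A) {x : A} → last xs ≡ just x → x ∈ xs
last≡just⇒∈ (y ∷ [])     refl = here refl
last≡just⇒∈ (y ∷ z ∷ xs) eq   = there (last≡just⇒∈ (z ∷ xs) eq)

module _ {n : ℕ} {E : Fin n → Fin n → Set} {C : List (Fin n)} (channel : IsChannel E C) where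
  open IsChannel channel

  lookup-reach : ∀ i j → i ≤ᶠ j → Reach E (lookup C i) (lookup C j)
  lookup-reach i j i≤j with lookup C i ≟ lookup C j
  ... | yes eq = subst (Reach E (lookup C i)) eq ε
  ... | no ne  = Equivalence.to (ordered i j ne) (≤∧≢⇒< i≤j λ { refl → ne refl })

  projPos-mono : ∀ {u v p q} → IsProjPos E C u p → IsProjPos E C v q →
                 Reach E u v → p ≤ q
  projPos-mono (i , refl , _ , minimal-u) (j , refl , v⇝j , _) u⇝v =
    ≮⇒≥ λ j<i → minimal-u j j<i (u⇝v ◅◅ v⇝j)

  projPos-reflect : ∀ {u v p q} → v ∈ C → IsProjPos E C u p → IsProjPos E C v q →
                    p ≤ q → Reach E u v
  projPos-reflect {u} {v} v∈C (i , refl , u⇝i , _) (j , refl , _ , minimal-v) p≤q =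
    subst (Reach E u) (sym v≡k) (u⇝i ◅◅ lookup-reach i k (≤-trans p≤q j≤k))
    where
    k = index v∈C
    v≡k : v ≡ lookup C k
    v≡k = lookup-index v∈C
    j≤k : toℕ j ≤ toℕ k
    j≤k = ≮⇒≥ λ k<j → minimal-v k k<j (subst (Reach E v) v≡k ε)

module _ {n : ℕ} {E : Fin n → Fin n → Set} {s t : Fin n} {C₁ C₂ : List (Fin n)}
         (decomposition : IsChannelDecomposition₂ E s t C₁ C₂) where
  open IsChannelDecomposition₂ decomposition

  channels-cover : ∀ v → v ∈ C₁ ⊎ v ∈ C₂
  channels-cover v with v ≟ s | v ≟ t
  ... | yes refl | _        = inj₁ (head≡just⇒∈ C₁ first₁)
  ... | no _     | yes refl = inj₁ (last≡just⇒∈ C₁ last₁)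
  ... | no v≢s   | no v≢t   = map proj₁ proj₁ (partition v v≢s v≢t)

lemma8 : (n : ℕ) (E : Fin n → Fin n → Set) (s t : Fin n) →
    IsSTGraph n E s t →
    (C₁ C₂ : List (Fin n)) → IsChannelDecomposition₂ E s t C₁ C₂ →
    (X Y : Fin n → ℕ) →
    (∀ v → IsProjPos E C₁ v (X v)) →
    (∀ v → IsProjPos E C₂ v (Y v)) →
    IsDominanceDrawing E X Y
lemma8 n E s t _ C₁ C₂ decomposition X Y projX projY u v = mk⇔ monotone reflect
  where
  open IsChannelDecomposition₂ decomposition

  monotone : Reach E u v → X u ≤ X v × Y u ≤ Y v
  monotone u⇝v = projPos-mono channel₁ (projX u) (projX v) u⇝v
               , projPos-mono channel₂ (projY u) (projY v) u⇝v

  reflect : X u ≤ X v × Y u ≤ Y v → Reach E u v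
  reflect (Xu≤Xv , Yu≤Yv) with channels-cover decomposition v
  ... | inj₁ v∈C₁ = projPos-reflect channel₁ v∈C₁ (projX u) (projX v) Xu≤Xv
  ... | inj₂ v∈C₂ = projPos-reflect channel₂ v∈C₂ (projY u) (projY v) Yu≤Yv
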